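{- Let $r\in\mathbb{Z}^+$, let $G_1$ be a finite graph, and let $G_2$ be a finite $3r$-regular graph. Suppose $G_2$ is 3-balanced. Then the lexicographic product $G_1\cdot G_2$ is 3-balanced.
   Context: A graph is 3-balanced if it admits a vertex coloring $\ell:V\to\mathbb{Z}_3$ such that every vertex has, in its open neighborhood, the same number of vertices of each of the three colors. The lexicographic product $G_1\cdot G_2$ has vertex set $V(G_1)\times V(G_2)$ with $(u,v)\sim(u',v')$ iff $uu'\in E(G_1)$, or $u=u'$ and $vv'\in E(G_2)$. -}

module Defs where

open import Data.Nat using (ℕ; zero; suc; _+_; _*_)
open import Data.Bool using (Bool; true; false; _∧_; _∨_; if_then_else_)
open import Data.Fin using (Fin; zero; suc; combine; remQuot; _≟_)
open import Data.Product using (Σ; _×_; _,_; proj₁; proj₂)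
open import Relation.Nullary using (yes; no)
open import Relation.Nullary.Decidable using (⌊_⌋)
open import Relation.Binary.PropositionalEquality using (_≡_; refl; sym; cong)

record Graph : Set where
  field
    n     : ℕ
    adj   : Fin n → Fin n → Bool
    adj-sym : ∀ u v → adj u v ≡ adj v u
    adj-irr : ∀ v → adj v v ≡ false
open Graph public

count : ∀ {m} → (Fin m → Bool) → ℕ
count {zero}  f = 0
count {suc m} f = (if f zero then 1 else 0) + count (λ i → f (suc i))

degree : (G : Graph) → Fin (n G) → ℕ
degree G v = count (λ u → adj G v u)

Regular : ℕ → Graph → Set
Regular k G = ∀ v → degree G v ≡ k

ℤ₃ : Set
ℤ₃ = Fin 3

colourCount : (G : Graph) → (Fin (n G) → ℤ₃) → Fin (n G) → ℤ₃ → ℕ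
colourCount G ℓ v c = count (λ u → adj G v u ∧ ⌊ ℓ u ≟ c ⌋)

ThreeBalanced : Graph → Set
ThreeBalanced G = Σ (Fin (n G) → ℤ₃) λ ℓ → ∀ v →
  (colourCount G ℓ v zero ≡ colourCount G ℓ v (suc zero)) ×
  (colourCount G ℓ v (suc zero) ≡ colourCount G ℓ v (suc (suc zero)))

eqb : ∀ {m} → Fin m → Fin m → Bool
eqb i j = ⌊ i ≟ j ⌋

eqb-sym : ∀ {m} (i j : Fin m) → eqb i j ≡ eqb j i
eqb-sym i j with i ≟ j | j ≟ i
... | yes _ | yes _ = refl
... | no _  | no _  = refl
... | yes p | no ¬q = Data.Empty.⊥-elim (¬q (sym p))
  where import Data.Empty
... | no ¬p | yes q = Data.Empty.⊥-elim (¬p (sym q))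
  where import Data.Empty

eqb-refl : ∀ {m} (i : Fin m) → eqb i i ≡ true
eqb-refl i with i ≟ i
... | yes _ = refl
... | no ¬p = Data.Empty.⊥-elim (¬p refl)
  where import Data.Empty

lexAdjPair : (G₁ G₂ : Graph) → Fin (n G₁) × Fin (n G₂) → Fin (n G₁) × Fin (n G₂) → Bool
lexAdjPair G₁ G₂ (u , v) (u' , v') = adj G₁ u u' ∨ (eqb u u' ∧ adj G₂ v v')

-- the vertex set Fin (n₁ * n₂) is identified with Fin n₁ × Fin n₂ via remQuot/combine
pair : (G₁ G₂ : Graph) → Fin (n G₁ * n G₂) → Fin (n G₁) × Fin (n G₂)
pair G₁ G₂ i = remQuot (n G₂) i

lexSym : (G₁ G₂ : Graph) → ∀ a b → lexAdjPair G₁ G₂ a b ≡ lexAdjPair G₁ G₂ b a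
lexSym G₁ G₂ (u , v) (u' , v')
  rewrite adj-sym G₁ u u' | eqb-sym u u' | adj-sym G₂ v v' = refl

lexIrr : (G₁ G₂ : Graph) → ∀ a → lexAdjPair G₁ G₂ a a ≡ false
lexIrr G₁ G₂ (u , v) rewrite adj-irr G₁ u | eqb-refl u | adj-irr G₂ v = refl

lex : Graph → Graph → Graph
lex G₁ G₂ = record
  { n   = n G₁ * n G₂
  ; adj = λ i j → lexAdjPair G₁ G₂ (pair G₁ G₂ i) (pair G₁ G₂ j)
  ; adj-sym = λ i j → lexSym G₁ G₂ (pair G₁ G₂ i) (pair G₁ G₂ j)
  ; adj-irr = λ i → lexIrr G₁ G₂ (pair G₁ G₂ i)
  }

{-# OPTIONS --safe #-}
-- Colour (u , v) by the colour of v in a balanced colouring of G₂. The neighbours of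
-- (u , v) are the whole fibres over the G₁-neighbours of u, each containing every
-- colour class of G₂ once, together with the G₂-neighbours of v inside the fibre over u.
-- So it suffices that the colour classes of G₂ have equal size, which follows by
-- double counting: in a k-regular graph, summing over all vertices the number of
-- neighbours of colour c gives k times the size of class c, and k = 3r is nonzero.
module Submission where

open import Defs
open import Data.Nat using (ℕ; zero; suc; _+_; _*_; _≥_; NonZero; s≤s)
open import Data.Nat.Properties using (+-assoc; *-cancelˡ-≡; *-identityˡ; +-*-semiring)
open import Data.Bool using (Bool; true; false; _∧_; if_then_else_)
open import Data.Fin using (Fin; zero; suc; _↑ˡ_; _↑ʳ_; combine; remQuot)
open import Data.Fin.Properties using (remQuot-combine)
open import Data.Product using (_×_; _,_; proj₁; proj₂)
open import Function using (_∘_)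
open import Relation.Binary.PropositionalEquality
  using (_≡_; refl; sym; trans; cong; module ≡-Reasoning)
open import Algebra.Properties.Semiring.Sum +-*-semiring
  using (sum-syntax; sum-cong-≗; ∑-comm; *-distribˡ-sum; *-distribʳ-sum)

open ≡-Reasoning

𝟙 : Bool → ℕ
𝟙 b = if b then 1 else 0

𝟙-∧ : ∀ a b → 𝟙 (a ∧ b) ≡ 𝟙 a * 𝟙 b
𝟙-∧ true  b = sym (*-identityˡ (𝟙 b))
𝟙-∧ false b = refl

count≡∑ : ∀ {m} (f : Fin m → Bool) → count f ≡ ∑[ i < m ] 𝟙 (f i)
count≡∑ {zero}  f = refl
count≡∑ {suc m} f = cong (𝟙 (f zero) +_) (count≡∑ (f ∘ suc))

∑-↑ : ∀ a {b} (f : Fin (a + b) → ℕ) →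
  ∑[ i < a + b ] f i ≡ ∑[ i < a ] f (i ↑ˡ b) + ∑[ j < b ] f (a ↑ʳ j)
∑-↑ zero    f = refl
∑-↑ (suc a) f = trans (cong (f zero +_) (∑-↑ a (f ∘ suc))) (sym (+-assoc (f zero) _ _))

∑-combine : ∀ m {k} (f : Fin (m * k) → ℕ) →
  ∑[ i < m * k ] f i ≡ ∑[ u < m ] ∑[ v < k ] f (combine u v)
∑-combine zero    f = refl
∑-combine (suc m) {k} f =
  trans (∑-↑ k f) (cong (∑[ v < k ] f (v ↑ˡ m * k) +_) (∑-combine m (f ∘ (k ↑ʳ_))))

count-remQuot : ∀ m k (g : Fin m × Fin k → Bool) →
  count (g ∘ remQuot {m} k) ≡ ∑[ u < m ] count (λ v → g (u , v))
count-remQuot m k g = begin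
  count (g ∘ remQuot k)
    ≡⟨ count≡∑ (g ∘ remQuot k) ⟩
  ∑[ i < m * k ] 𝟙 (g (remQuot k i))
    ≡⟨ ∑-combine m _ ⟩
  ∑[ u < m ] ∑[ v < k ] 𝟙 (g (remQuot k (combine u v)))
    ≡⟨ sum-cong-≗ (λ u → sum-cong-≗ (λ v → cong (𝟙 ∘ g) (remQuot-combine u v))) ⟩
  ∑[ u < m ] ∑[ v < k ] 𝟙 (g (u , v))
    ≡⟨ sum-cong-≗ (λ u → sym (count≡∑ (λ v → g (u , v)))) ⟩
  ∑[ u < m ] count (λ v → g (u , v))
    ∎

neighbourCount : (G : Graph) → (Fin (n G) → Bool) → Fin (n G) → ℕ
neighbourCount G P v = count (λ u → adj G v u ∧ P u)

∑-neighbourCount-regular : ∀ {k} (G : Graph) → Regular k G → (P : Fin (n G) → Bool) →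
  ∑[ v < n G ] neighbourCount G P v ≡ k * count P
∑-neighbourCount-regular {k} G reg P = begin
  ∑[ v < n G ] neighbourCount G P v
    ≡⟨ sum-cong-≗ (λ v → count≡∑ (λ u → adj G v u ∧ P u)) ⟩
  ∑[ v < n G ] ∑[ u < n G ] 𝟙 (adj G v u ∧ P u)
    ≡⟨ ∑-comm (λ v u → 𝟙 (adj G v u ∧ P u)) ⟩
  ∑[ u < n G ] ∑[ v < n G ] 𝟙 (adj G v u ∧ P u)
    ≡⟨ sum-cong-≗ (λ u → sum-cong-≗ (split u)) ⟩
  ∑[ u < n G ] ∑[ v < n G ] (𝟙 (adj G u v) * 𝟙 (P u))
    ≡⟨ sum-cong-≗ (λ u → sym (*-distribʳ-sum (𝟙 (P u)) (λ v → 𝟙 (adj G u v)))) ⟩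
  ∑[ u < n G ] ((∑[ v < n G ] 𝟙 (adj G u v)) * 𝟙 (P u))
    ≡⟨ sum-cong-≗ (λ u → cong (_* 𝟙 (P u)) (degree≡ u)) ⟩
  ∑[ u < n G ] (k * 𝟙 (P u))
    ≡⟨ *-distribˡ-sum k (𝟙 ∘ P) ⟨
  k * ∑[ u < n G ] 𝟙 (P u)
    ≡⟨ cong (k *_) (count≡∑ P) ⟨
  k * count P
    ∎
  where
  split : ∀ u v → 𝟙 (adj G v u ∧ P u) ≡ 𝟙 (adj G u v) * 𝟙 (P u)
  split u v = trans (cong (λ b → 𝟙 (b ∧ P u)) (adj-sym G v u)) (𝟙-∧ (adj G u v) (P u))

  degree≡ : ∀ u → ∑[ v < n G ] 𝟙 (adj G u v) ≡ k
  degree≡ u = trans (sym (count≡∑ (adj G u))) (reg u)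

regular-neighbourCount-injective : ∀ {k} .{{_ : NonZero k}} (G : Graph) → Regular k G →
  {P Q : Fin (n G) → Bool} → (∀ v → neighbourCount G P v ≡ neighbourCount G Q v) →
  count P ≡ count Q
regular-neighbourCount-injective {k} G reg {P} {Q} eq = *-cancelˡ-≡ (count P) (count Q) k (begin
  k * count P                          ≡⟨ ∑-neighbourCount-regular G reg P ⟨
  ∑[ v < n G ] neighbourCount G P v    ≡⟨ sum-cong-≗ eq ⟩
  ∑[ v < n G ] neighbourCount G Q v    ≡⟨ ∑-neighbourCount-regular G reg Q ⟩
  k * count Q                          ∎)

module _ (G₁ G₂ : Graph) where

  onFactor₂ : (Fin (n G₂) → Bool) → Fin (n (lex G₁ G₂)) → Bool
  onFactor₂ P = P ∘ proj₂ ∘ pair G₁ G₂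

  neighbourCount-lex : ∀ P i → neighbourCount (lex G₁ G₂) (onFactor₂ P) i ≡
    ∑[ u' < n G₁ ] count (λ v' → lexAdjPair G₁ G₂ (pair G₁ G₂ i) (u' , v') ∧ P v')
  neighbourCount-lex P i =
    count-remQuot (n G₁) (n G₂) (λ p → lexAdjPair G₁ G₂ (pair G₁ G₂ i) p ∧ P (proj₂ p))

  lex-neighbourCount-cong : {P Q : Fin (n G₂) → Bool} → count P ≡ count Q →
    (∀ v → neighbourCount G₂ P v ≡ neighbourCount G₂ Q v) →
    ∀ i → neighbourCount (lex G₁ G₂) (onFactor₂ P) i ≡ neighbourCount (lex G₁ G₂) (onFactor₂ Q) i
  lex-neighbourCount-cong {P} {Q} sizes nbrs i = begin
    neighbourCount (lex G₁ G₂) (onFactor₂ P) i  ≡⟨ neighbourCount-lex P i ⟩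
    ∑[ u' < n G₁ ] fibre P u'               ≡⟨ sum-cong-≗ fibre-cong ⟩
    ∑[ u' < n G₁ ] fibre Q u'               ≡⟨ neighbourCount-lex Q i ⟨
    neighbourCount (lex G₁ G₂) (onFactor₂ Q) i  ∎
    where
    u = proj₁ (pair G₁ G₂ i)
    v = proj₂ (pair G₁ G₂ i)

    fibre : (Fin (n G₂) → Bool) → Fin (n G₁) → ℕ
    fibre R u' = count (λ v' → lexAdjPair G₁ G₂ (u , v) (u' , v') ∧ R v')

    fibre-cong : ∀ u' → fibre P u' ≡ fibre Q u'
    fibre-cong u' with adj G₁ u u' | eqb u u'
    ... | true  | _     = sizes
    ... | false | true  = nbrs v
    ... | false | false = refl

theorem6p9 : (r : ℕ) → r ≥ 1 → (G₁ G₂ : Graph) →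
    Regular (3 * r) G₂ → ThreeBalanced G₂ → ThreeBalanced (lex G₁ G₂)
theorem6p9 (suc r) (s≤s _) G₁ G₂ reg (ℓ , balanced) =
  ℓ ∘ proj₂ ∘ pair G₁ G₂ , λ i → lift (proj₁ ∘ balanced) i , lift (proj₂ ∘ balanced) i
  where
  lift : ∀ {c d} → (∀ v → colourCount G₂ ℓ v c ≡ colourCount G₂ ℓ v d) →
    ∀ i → colourCount (lex G₁ G₂) (ℓ ∘ proj₂ ∘ pair G₁ G₂) i c ≡
          colourCount (lex G₁ G₂) (ℓ ∘ proj₂ ∘ pair G₁ G₂) i d
  lift nbrs = lex-neighbourCount-cong G₁ G₂ (regular-neighbourCount-injective G₂ reg nbrs) nbrs
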